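{- Let $(A,\rightarrow,\rightsquigarrow,1)$ be a pseudo BCK-algebra and $\mu$ a type I or a type II state operator on $A$. Then: (1) $\mu(1)=1$; (2) $\mu(\mu(x))=\mu(x)$ for all $x\in A$; (3) $\mu(x\rightarrow y)\le\mu(x)\rightarrow\mu(y)$ and $\mu(x\rightsquigarrow y)\le\mu(x)\rightsquigarrow\mu(y)$ for all $x,y\in A$; (4) ${\rm Ker}(\mu)$ is a deductive system of $A$; (5) ${\rm Im}(\mu)$ is a subalgebra of $A$ (contains $1$ and is closed under $\rightarrow$ and $\rightsquigarrow$); (6) ${\rm Im}(\mu)=\{x\in A\mid x=\mu(x)\}$; (7) ${\rm Ker}(\mu)\cap{\rm Im}(\mu)=\{1\}$; (8) if $A$ is commutative then $\mu(x\rightarrow y)\rightsquigarrow\mu(y)=\mu(x\rightsquigarrow y)\rightarrow\mu(y)$ for all $x,y\in A$.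
   Context: A pseudo BCK-algebra is an algebra $(A,\rightarrow,\rightsquigarrow,1)$ of type $(2,2,0)$ such that for all $x,y,z\in A$: $(x\rightarrow y)\rightsquigarrow[(y\rightarrow z)\rightsquigarrow(x\rightarrow z)]=1$; $(x\rightsquigarrow y)\rightarrow[(y\rightsquigarrow z)\rightarrow(x\rightsquigarrow z)]=1$; $1\rightarrow x=x$; $1\rightsquigarrow x=x$; $x\rightarrow 1=1$; and if $x\rightarrow y=1$ and $y\rightarrow x=1$ then $x=y$. The order is $x\le y$ iff $x\rightarrow y=1$ (iff $x\rightsquigarrow y=1$). $A$ is commutative if $(x\rightarrow y)\rightsquigarrow y=(y\rightarrow x)\rightsquigarrow x$ and $(x\rightsquigarrow y)\rightarrow y=(y\rightsquigarrow x)\rightarrow x$ for all $x,y$. A deductive system is a subset $D$ with $1\in D$ such that $x, x\rightarrow y\in D$ imply $y\in D$. For $\mu:A\to A$ consider, for all $x,y\in A$: $(IS_1)$ $x\le y$ implies $\mu(x)\le\mu(y)$; $(IS_2)$ $\mu(x\rightarrow y)=\mu((x\rightarrow y)\rightsquigarrow y)\rightarrow\mu(y)$ and $\mu(x\rightsquigarrow y)=\mu((x\rightsquigarrow y)\rightarrow y)\rightsquigarrow\mu(y)$; $(IS_2')$ $\mu(x\rightarrow y)=\mu((y\rightarrow x)\rightsquigarrow x)\rightarrow\mu(y)$ and $\mu(x\rightsquigarrow y)=\mu((y\rightsquigarrow x)\rightarrow x)\rightsquigarrow\mu(y)$; $(IS_3)$ $\mu(\mu(x)\rightarrow\mu(y))=\mu(x)\rightarrow\mu(y)$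 and $\mu(\mu(x)\rightsquigarrow\mu(y))=\mu(x)\rightsquigarrow\mu(y)$. A type I state operator satisfies $(IS_1),(IS_2),(IS_3)$; a type II state operator satisfies $(IS_1),(IS_2'),(IS_3)$. ${\rm Ker}(\mu)=\{x\in A\mid\mu(x)=1\}$. -}

module Defs where

open import Level using (Level; suc; _⊔_)
open import Data.Product using (Σ; ∃; _×_; _,_)
open import Data.Sum using (_⊎_)
open import Relation.Binary.PropositionalEquality using (_≡_)

record PseudoBCK (a : Level) : Set (suc a) where
  infixr 5 _⇒_ _⇝_
  field
    Carrier : Set a
    _⇒_     : Carrier → Carrier → Carrier
    _⇝_     : Carrier → Carrier → Carrier
    one     : Carrier
    ax1     : ∀ x y z → (x ⇒ y) ⇝ ((y ⇒ z) ⇝ (x ⇒ z)) ≡ one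
    ax2     : ∀ x y z → (x ⇝ y) ⇒ ((y ⇝ z) ⇒ (x ⇝ z)) ≡ one
    ax3     : ∀ x → one ⇒ x ≡ x
    ax4     : ∀ x → one ⇝ x ≡ x
    ax5     : ∀ x → x ⇒ one ≡ one
    ax6     : ∀ x y → x ⇒ y ≡ one → y ⇒ x ≡ one → x ≡ y

  _≤_ : Carrier → Carrier → Set a
  x ≤ y = x ⇒ y ≡ one

  commutative : Set a
  commutative = ∀ x y → ((x ⇒ y) ⇝ y ≡ (y ⇒ x) ⇝ x)
                      × ((x ⇝ y) ⇒ y ≡ (y ⇝ x) ⇒ x)

  IsDeductiveSystem : (Carrier → Set a) → Set a
  IsDeductiveSystem D = D one × (∀ x y → D x → D (x ⇒ y) → D y)

  IsSubalgebra : (Carrier → Set a) → Set a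
  IsSubalgebra S = S one × (∀ x y → S x → S y → S (x ⇒ y))
                         × (∀ x y → S x → S y → S (x ⇝ y))

  module _ (μ : Carrier → Carrier) where
    IS1 : Set a
    IS1 = ∀ x y → x ≤ y → μ x ≤ μ y

    IS2 : Set a
    IS2 = ∀ x y → (μ (x ⇒ y) ≡ μ ((x ⇒ y) ⇝ y) ⇒ μ y)
                × (μ (x ⇝ y) ≡ μ ((x ⇝ y) ⇒ y) ⇝ μ y)

    IS2' : Set a
    IS2' = ∀ x y → (μ (x ⇒ y) ≡ μ ((y ⇒ x) ⇝ x) ⇒ μ y)
                 × (μ (x ⇝ y) ≡ μ ((y ⇝ x) ⇒ x) ⇝ μ y)

    IS3 : Set a
    IS3 = ∀ x y → (μ (μ x ⇒ μ y) ≡ μ x ⇒ μ y)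
                × (μ (μ x ⇝ μ y) ≡ μ x ⇝ μ y)

    IsTypeIStateOp : Set a
    IsTypeIStateOp = IS1 × IS2 × IS3

    IsTypeIIStateOp : Set a
    IsTypeIIStateOp = IS1 × IS2' × IS3

    Ker : Carrier → Set a
    Ker x = μ x ≡ one

    Im : Carrier → Set a
    Im x = ∃ λ y → μ y ≡ x

-- Types I and II differ only in the upper bound u of x through which μ factors:
-- μ (x → y) = μ u → μ y with x ≤ u (u = (x → y) ⇝ y, resp. u = (y → x) ⇝ x, and dually
-- for ⇝).  Monotonicity with antitonicity of → in its first argument then gives (3), and
-- (1), (2), (4)–(7) follow from (3) and (IS3).  In a commutative algebra (IS2') coincides
-- with (IS2), and both sides of (8) collapse to μ ((x → y) ⇝ y) because
-- (u → y) ⇝ y = u = (u ⇝ y) → y whenever y ≤ u.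
module Submission where

open import Defs
open import Level using (Level)
open import Data.Product using (_×_; _,_; proj₁; proj₂)
open import Data.Sum using (_⊎_; inj₁; inj₂)
open import Relation.Binary.PropositionalEquality
open import Function.Bundles using (_⇔_; mk⇔; Equivalence)

module PseudoBCKProperties {a : Level} (A : PseudoBCK a) where
  open PseudoBCK A

  x≤[x⇝y]⇒y : ∀ x y → x ≤ ((x ⇝ y) ⇒ y)
  x≤[x⇝y]⇒y x y = subst₂ (λ s t → s ⇒ ((x ⇝ y) ⇒ t) ≡ one) (ax4 x) (ax4 y) (ax2 one x y)

  x⇝[x⇒y]⇝y≡one : ∀ x y → x ⇝ ((x ⇒ y) ⇝ y) ≡ one
  x⇝[x⇒y]⇝y≡one x y = subst₂ (λ s t → s ⇝ ((x ⇒ y) ⇝ t) ≡ one) (ax3 x) (ax3 y) (ax1 one x y)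

  ≤-refl : ∀ x → x ≤ x
  ≤-refl x = subst (_≡ one) (trans (ax3 _) (cong (_⇒ x) (ax4 x))) (x≤[x⇝y]⇒y one x)

  ≤⇒⇝≡one : ∀ {x y} → x ≤ y → x ⇝ y ≡ one
  ≤⇒⇝≡one {x} {y} x≤y =
    subst (λ t → x ⇝ t ≡ one) (trans (cong (_⇝ y) x≤y) (ax4 y)) (x⇝[x⇒y]⇝y≡one x y)

  ⇝≡one⇒≤ : ∀ {x y} → x ⇝ y ≡ one → x ≤ y
  ⇝≡one⇒≤ {x} {y} x⇝y≡one =
    subst (λ t → x ⇒ t ≡ one) (trans (cong (_⇒ y) x⇝y≡one) (ax3 y)) (x≤[x⇝y]⇒y x y)

  x≤[x⇒y]⇝y : ∀ x y → x ≤ ((x ⇒ y) ⇝ y)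
  x≤[x⇒y]⇝y x y = ⇝≡one⇒≤ (x⇝[x⇒y]⇝y≡one x y)

  ⇒-antitoneˡ : ∀ {x y} z → x ≤ y → (y ⇒ z) ≤ (x ⇒ z)
  ⇒-antitoneˡ {x} {y} z x≤y =
    ⇝≡one⇒≤ (trans (sym (ax4 _)) (subst (λ t → t ⇝ _ ≡ one) x≤y (ax1 x y z)))

  ⇝-antitoneˡ : ∀ {x y} z → x ≤ y → (y ⇝ z) ≤ (x ⇝ z)
  ⇝-antitoneˡ {x} {y} z x≤y =
    trans (sym (ax3 _)) (subst (λ t → t ⇒ _ ≡ one) (≤⇒⇝≡one x≤y) (ax2 x y z))

  x≤y⇒x : ∀ x y → x ≤ (y ⇒ x)
  x≤y⇒x x y = subst (λ t → t ⇒ (y ⇒ x) ≡ one) (ax3 x) (⇒-antitoneˡ x (ax5 y))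

  x≤y⇝x : ∀ x y → x ≤ (y ⇝ x)
  x≤y⇝x x y = subst (λ t → t ⇒ (y ⇝ x) ≡ one) (ax4 x) (⇝-antitoneˡ x (ax5 y))

  module Commutative (comm : commutative) where

    [x⇒y]⇝y≡x : ∀ {x y} → y ≤ x → (x ⇒ y) ⇝ y ≡ x
    [x⇒y]⇝y≡x {x} {y} y≤x = trans (proj₁ (comm x y)) (trans (cong (_⇝ x) y≤x) (ax4 x))

    [x⇝y]⇒y≡x : ∀ {x y} → y ≤ x → (x ⇝ y) ⇒ y ≡ x
    [x⇝y]⇒y≡x {x} {y} y≤x =
      trans (proj₂ (comm x y)) (trans (cong (_⇒ x) (≤⇒⇝≡one y≤x)) (ax3 x))

    [x⇒y]⇝y-least : ∀ {x y z} → x ≤ z → y ≤ z → ((x ⇒ y) ⇝ y) ≤ z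
    [x⇒y]⇝y-least {x} {y} {z} x≤z y≤z =
      subst (λ t → ((x ⇒ y) ⇝ y) ⇒ t ≡ one) ([x⇒y]⇝y≡x y≤z)
        (⇝-antitoneˡ y (⇒-antitoneˡ y x≤z))

    [x⇒y]⇝y≡[x⇝y]⇒y : ∀ x y → (x ⇒ y) ⇝ y ≡ (x ⇝ y) ⇒ y
    [x⇒y]⇝y≡[x⇝y]⇒y x y = ax6 _ _
      ([x⇒y]⇝y-least (x≤[x⇝y]⇒y x y) (x≤y⇒x y (x ⇝ y)))
      (subst (λ t → ((x ⇝ y) ⇒ y) ⇒ t ≡ one) ([x⇝y]⇒y≡x (x≤y⇝x y (x ⇒ y)))
        (⇒-antitoneˡ y (⇝-antitoneˡ y (x≤[x⇒y]⇝y x y))))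

    IS2'⇒IS2 : ∀ {μ} → IS2' μ → IS2 μ
    IS2'⇒IS2 {μ} is2' x y =
        trans (proj₁ (is2' x y)) (cong (λ t → μ t ⇒ μ y) (proj₁ (comm y x)))
      , trans (proj₂ (is2' x y)) (cong (λ t → μ t ⇝ μ y) (proj₂ (comm y x)))

    IS2⇒μ[x⇒y]⇝μy≡μ[x⇝y]⇒μy : ∀ {μ} → IS1 μ → IS2 μ →
                               ∀ x y → μ (x ⇒ y) ⇝ μ y ≡ μ (x ⇝ y) ⇒ μ y
    IS2⇒μ[x⇒y]⇝μy≡μ[x⇝y]⇒μy {μ} mono is2 x y = begin
      μ (x ⇒ y) ⇝ μ y           ≡⟨ cong (_⇝ μ y) (proj₁ (is2 x y)) ⟩
      (μ u ⇒ μ y) ⇝ μ y         ≡⟨ [x⇒y]⇝y≡x μy≤μu ⟩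
      μ u                       ≡⟨ sym ([x⇝y]⇒y≡x μy≤μu) ⟩
      (μ u ⇝ μ y) ⇒ μ y         ≡⟨ cong (λ t → (μ t ⇝ μ y) ⇒ μ y) ([x⇒y]⇝y≡[x⇝y]⇒y x y) ⟩
      (μ ((x ⇝ y) ⇒ y) ⇝ μ y) ⇒ μ y ≡⟨ cong (_⇒ μ y) (sym (proj₂ (is2 x y))) ⟩
      μ (x ⇝ y) ⇒ μ y           ∎
      where
      open ≡-Reasoning
      u = (x ⇒ y) ⇝ y
      μy≤μu : μ y ≤ μ u
      μy≤μu = mono _ _ (x≤y⇝x y (x ⇒ y))

  record Factorisation (μ : Carrier → Carrier) : Set a where
    field
      bound⇒ bound⇝ : Carrier → Carrier → Carrier
      ≤-bound⇒      : ∀ x y → x ≤ bound⇒ x y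
      ≤-bound⇝      : ∀ x y → x ≤ bound⇝ x y
      μ-⇒           : ∀ x y → μ (x ⇒ y) ≡ μ (bound⇒ x y) ⇒ μ y
      μ-⇝           : ∀ x y → μ (x ⇝ y) ≡ μ (bound⇝ x y) ⇝ μ y

  IS2⇒Factorisation : ∀ {μ} → IS2 μ → Factorisation μ
  IS2⇒Factorisation is2 = record
    { ≤-bound⇒ = x≤[x⇒y]⇝y
    ; ≤-bound⇝ = x≤[x⇝y]⇒y
    ; μ-⇒      = λ x y → proj₁ (is2 x y)
    ; μ-⇝      = λ x y → proj₂ (is2 x y)
    }

  IS2'⇒Factorisation : ∀ {μ} → IS2' μ → Factorisation μ
  IS2'⇒Factorisation is2' = record
    { ≤-bound⇒ = λ x y → x≤y⇝x x (y ⇒ x)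
    ; ≤-bound⇝ = λ x y → x≤y⇒x x (y ⇝ x)
    ; μ-⇒      = λ x y → proj₁ (is2' x y)
    ; μ-⇝      = λ x y → proj₂ (is2' x y)
    }

  module StateOperator {μ : Carrier → Carrier}
                       (mono : IS1 μ) (closure : IS3 μ) (fact : Factorisation μ) where
    open Factorisation fact
    open ≡-Reasoning

    μ-one : μ one ≡ one
    μ-one = begin
      μ one                          ≡⟨ cong μ (sym (ax3 one)) ⟩
      μ (one ⇒ one)                  ≡⟨ μ-⇒ one one ⟩
      μ (bound⇒ one one) ⇒ μ one     ≡⟨ cong (λ t → μ t ⇒ μ one) bound≡one ⟩
      μ one ⇒ μ one                  ≡⟨ ≤-refl (μ one) ⟩
      one                            ∎
      where
      bound≡one : bound⇒ one one ≡ one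
      bound≡one = ax6 _ _ (ax5 _) (≤-bound⇒ one one)

    μ-idem : ∀ x → μ (μ x) ≡ μ x
    μ-idem x = begin
      μ (μ x)             ≡⟨ cong μ (sym one⇒μx≡μx) ⟩
      μ (μ one ⇒ μ x)     ≡⟨ proj₁ (closure one x) ⟩
      μ one ⇒ μ x         ≡⟨ one⇒μx≡μx ⟩
      μ x                 ∎
      where
      one⇒μx≡μx : μ one ⇒ μ x ≡ μ x
      one⇒μx≡μx = trans (cong (_⇒ μ x) μ-one) (ax3 (μ x))

    μ-⇒-≤ : ∀ x y → μ (x ⇒ y) ≤ (μ x ⇒ μ y)
    μ-⇒-≤ x y = subst (λ t → t ⇒ (μ x ⇒ μ y) ≡ one) (sym (μ-⇒ x y))
                  (⇒-antitoneˡ (μ y) (mono _ _ (≤-bound⇒ x y)))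

    μ-⇝-≤ : ∀ x y → μ (x ⇝ y) ≤ (μ x ⇝ μ y)
    μ-⇝-≤ x y = subst (λ t → t ⇒ (μ x ⇝ μ y) ≡ one) (sym (μ-⇝ x y))
                  (⇝-antitoneˡ (μ y) (mono _ _ (≤-bound⇝ x y)))

    Ker-isDeductiveSystem : IsDeductiveSystem (Ker μ)
    Ker-isDeductiveSystem = μ-one , λ x y μx≡one μ[x⇒y]≡one → begin
      μ y                       ≡⟨ sym (ax3 (μ y)) ⟩
      one ⇒ μ y                 ≡⟨ cong (_⇒ μ y) (sym μx≡one) ⟩
      μ x ⇒ μ y                 ≡⟨ sym (ax3 _) ⟩
      one ⇒ (μ x ⇒ μ y)         ≡⟨ cong (_⇒ (μ x ⇒ μ y)) (sym μ[x⇒y]≡one) ⟩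
      μ (x ⇒ y) ⇒ (μ x ⇒ μ y)   ≡⟨ μ-⇒-≤ x y ⟩
      one                       ∎

    Im-isSubalgebra : IsSubalgebra (Im μ)
    Im-isSubalgebra =
        (one , μ-one)
      , (λ { _ _ (p , refl) (q , refl) → (μ p ⇒ μ q) , proj₁ (closure p q) })
      , (λ { _ _ (p , refl) (q , refl) → (μ p ⇝ μ q) , proj₂ (closure p q) })

    Im⇔fixed : ∀ x → Im μ x ⇔ (x ≡ μ x)
    Im⇔fixed x = mk⇔ (λ { (y , refl) → sym (μ-idem y) }) (λ x≡μx → x , sym x≡μx)

    Ker∩Im⇔one : ∀ x → (Ker μ x × Im μ x) ⇔ (x ≡ one)
    Ker∩Im⇔one x = mk⇔
      (λ { (μx≡one , imx) → trans (Equivalence.to (Im⇔fixed x) imx) μx≡one })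
      (λ { refl → μ-one , (one , μ-one) })

  module _ {μ : Carrier → Carrier} where

    monotone : IsTypeIStateOp μ ⊎ IsTypeIIStateOp μ → IS1 μ
    monotone (inj₁ (mono , _ , _)) = mono
    monotone (inj₂ (mono , _ , _)) = mono

    closed : IsTypeIStateOp μ ⊎ IsTypeIIStateOp μ → IS3 μ
    closed (inj₁ (_ , _ , cl)) = cl
    closed (inj₂ (_ , _ , cl)) = cl

    factorisation : IsTypeIStateOp μ ⊎ IsTypeIIStateOp μ → Factorisation μ
    factorisation (inj₁ (_ , is2 , _))  = IS2⇒Factorisation is2
    factorisation (inj₂ (_ , is2' , _)) = IS2'⇒Factorisation is2'

    IS2-if-commutative : IsTypeIStateOp μ ⊎ IsTypeIIStateOp μ → commutative → IS2 μ
    IS2-if-commutative (inj₁ (_ , is2 , _))  _    = is2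
    IS2-if-commutative (inj₂ (_ , is2' , _)) comm = Commutative.IS2'⇒IS2 comm is2'

proposition5p5 : ∀ {a : Level} (A : PseudoBCK a) (μ : PseudoBCK.Carrier A → PseudoBCK.Carrier A) →
    let open PseudoBCK A in
    (IsTypeIStateOp μ ⊎ IsTypeIIStateOp μ) →
      (μ one ≡ one)
      × (∀ x → μ (μ x) ≡ μ x)
      × (∀ x y → (μ (x ⇒ y) ≤ (μ x ⇒ μ y)) × (μ (x ⇝ y) ≤ (μ x ⇝ μ y)))
      × IsDeductiveSystem (Ker μ)
      × IsSubalgebra (Im μ)
      × (∀ x → Im μ x ⇔ (x ≡ μ x))
      × (∀ x → (Ker μ x × Im μ x) ⇔ (x ≡ one))
      × (commutative → ∀ x y → μ (x ⇒ y) ⇝ μ y ≡ μ (x ⇝ y) ⇒ μ y)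
proposition5p5 A μ stateOp =
    μ-one , μ-idem , (λ x y → μ-⇒-≤ x y , μ-⇝-≤ x y)
  , Ker-isDeductiveSystem , Im-isSubalgebra , Im⇔fixed , Ker∩Im⇔one
  , λ comm → Commutative.IS2⇒μ[x⇒y]⇝μy≡μ[x⇝y]⇒μy comm
                (monotone stateOp) (IS2-if-commutative stateOp comm)
  where
  open PseudoBCKProperties A
  open StateOperator (monotone stateOp) (closed stateOp) (factorisation stateOp)
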